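{- Let $a, b$ be relatively prime positive integers such that $\frac{a}{b} > 1$ and $b \geq 2$. Then $\textbf{w}_{\geq a/b} \neq \textbf{w}_{a/b}$.
   Context: A factor is a contiguous subword. For relatively prime positive integers $p,q$ and a nonempty word $v$ whose length is divisible by $q$, define $v^{p/q} = v^{\lfloor p/q \rfloor} v_0 v_1 \cdots v_{t-1}$, where $t = |v|\,(p/q - \lfloor p/q\rfloor)$; such a word is called a $\frac{p}{q}$-power. A word avoids $\frac{p}{q}$-powers if none of its factors is a $\frac{p}{q}$-power. For $\frac{a}{b}>1$ with $a,b$ coprime, $\textbf{w}_{a/b}$ is the lexicographically least infinite word over $\mathbb{Z}_{\geq 0}$ avoiding $\frac{a}{b}$-powers, and $\textbf{w}_{\geq a/b}$ is the lexicographically least infinite word over $\mathbb{Z}_{\geq 0}$ avoiding $\frac{p}{q}$-powers for all rationals $\frac{p}{q} \geq \frac{a}{b}$. -}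

module Defs where

open import Data.Nat using (ℕ; zero; suc; _+_; _*_; _<_; _≤_; NonZero)
open import Data.Nat.DivMod using (_/_; _%_)
open import Data.Nat.Divisibility using (_∣_)
open import Data.Nat.Coprimality using (Coprime)
open import Data.List using (List; []; _++_; length; take; concat; replicate; map; upTo)
open import Data.Product using (Σ; _×_; ∃)
open import Relation.Binary.PropositionalEquality using (_≡_; _≢_)
open import Relation.Nullary using (¬_)

Word : Set
Word = List ℕ

InfWord : Set
InfWord = ℕ → ℕ

-- v^{p/q} = v^{⌊p/q⌋} v₀ ⋯ v_{t-1},  t = |v| (p/q − ⌊p/q⌋) = |v| (p mod q) / q
power : Word → (p q : ℕ) → .{{NonZero q}} → Word
power v p q = concat (replicate (p / q) v) ++ take ((length v * (p % q)) / q) v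

IsPower : (p q : ℕ) → .{{NonZero q}} → Word → Set
IsPower p q x = Σ Word λ v → (v ≢ []) × (q ∣ length v) × (x ≡ power v p q)

factor : InfWord → ℕ → ℕ → Word
factor w i n = map (λ k → w (i + k)) (upTo n)

Avoids : (p q : ℕ) → .{{NonZero q}} → InfWord → Set
Avoids p q w = ∀ i n → ¬ IsPower p q (factor w i n)

AvoidsGE : (a b : ℕ) → InfWord → Set
AvoidsGE a b w = ∀ p q .{{_ : NonZero q}} → Coprime p q → a * q ≤ p * b → Avoids p q w

_<lex_ : InfWord → InfWord → Set
u <lex w = ∃ λ i → (∀ j → j < i → u j ≡ w j) × (u i < w i)

IsLexLeast : (InfWord → Set) → InfWord → Set
IsLexLeast P w = P w × (∀ u → P u → ¬ (u <lex w))

module Submission where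

-- Put c = ⌊a/b⌋ + 1.  Then c/1 ≥ a/b, so w≥ avoids c-powers and in
-- particular never contains the block 0^c.  On the other hand the lexicographically
-- least a/b-power-free word w starts with a − 1 ≥ c zeros: if its first nonzero
-- letter sat at a position m < a − 1, the word 0^{m+1} followed by "fresh" letters
-- (letters never seen before) would be a/b-power-free and lexicographically smaller.
-- It is power-free because the last letter of an occurrence of an a/b-power repeats
-- the letter |v| positions earlier, and that last letter lies at a position ≥ a − 1,
-- where the word only has fresh letters.

open import Defs
open import Data.Nat using (ℕ; _<_; _≤_; NonZero)
open import Data.Nat.Coprimality using (Coprime)
open import Relation.Binary.PropositionalEquality using (_≡_)
open import Relation.Nullary using (¬_)

open import Data.Nat using (zero; suc; pred; _+_; _*_; _⊓_; z≤n; s≤s; z<s; _≤?_; >-nonZero)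
open import Data.Nat.Properties
open import Data.Nat.DivMod using (_/_; _%_; m≡m%n+[m/n]*n; n%1≡0; m%n<n; n/1≡n; m*n/n≡m; m/n*n≤m; m≥n⇒m/n>0)
open import Data.Nat.Divisibility using (_∣_; divides; 1∣_)
open import Data.Nat.Coprimality using (1-coprimeTo) renaming (sym to coprime-sym)
open import Data.List using ([]; _∷_; [_]; _++_; length; take; drop; concat; replicate; map; upTo; applyUpTo)
open import Data.List.Properties
  using (++-identityʳ; ++-assoc; length-++; length-take; take++drop≡id; length-map; length-upTo;
         map-upTo; map-∘; map-cong; map-replicate; concat-map-[_]; ∷-injective)
open import Data.Product using (_×_; ∃; ∃₂; _,_; proj₁; proj₂)
open import Data.Sum using (inj₁; inj₂)
open import Data.Empty using (⊥-elim)
open import Relation.Nullary using (yes; no; contradiction)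
open import Relation.Binary.PropositionalEquality using (refl; sym; trans; cong; cong₂; subst; subst₂; _≢_; module ≡-Reasoning)

factor-suc : ∀ w i n → factor w i (suc n) ≡ w i ∷ factor w (suc i) n
factor-suc w i n = cong₂ _∷_ (cong w (+-identityʳ i)) (begin
  map letter (applyUpTo suc n)             ≡⟨ cong (map letter) (sym (map-upTo suc n)) ⟩
  map letter (map suc (upTo n))            ≡⟨ sym (map-∘ (upTo n)) ⟩
  map (λ k → letter (suc k)) (upTo n)      ≡⟨ map-cong (λ k → cong w (+-suc i k)) (upTo n) ⟩
  factor w (suc i) n                       ∎)
  where
  open ≡-Reasoning
  letter : ℕ → ℕ
  letter k = w (i + k)

length-factor : ∀ w i n → length (factor w i n) ≡ n
length-factor w i n = trans (length-map (λ k → w (i + k)) (upTo n)) (length-upTo n)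

factor-++ : ∀ w i n (x y : Word) → factor w i n ≡ x ++ y →
  x ≡ factor w i (length x) × y ≡ factor w (i + length x) (length y)
factor-++ w i n [] y occ = refl , trans (sym occ) (cong₂ (factor w) (sym (+-identityʳ i)) n≡|y|)
  where
  n≡|y| : n ≡ length y
  n≡|y| = trans (sym (length-factor w i n)) (cong length occ)
factor-++ w i zero (z ∷ x) y ()
factor-++ w i (suc n) (z ∷ x) y occ
  with ∷-injective (trans (sym (factor-suc w i n)) occ)
... | w≡z , rest with factor-++ w (suc i) n x y rest
...   | x≡ , y≡ =
  trans (cong₂ _∷_ (sym w≡z) x≡) (sym (factor-suc w i (length x))) ,
  trans y≡ (cong (λ j → factor w j (length y)) (sym (+-suc i (length x))))

factor-suc-injective : ∀ w j k n → factor w j (suc n) ≡ factor w k (suc n) →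
  w j ≡ w k × factor w (suc j) n ≡ factor w (suc k) n
factor-suc-injective w j k n same = ∷-injective (trans (sym (factor-suc w j n)) (trans same (factor-suc w k n)))

factor-pointwise : ∀ w j k n → factor w j n ≡ factor w k n → ∀ m → m < n → w (j + m) ≡ w (k + m)
factor-pointwise w j k (suc n) same zero _ = begin
  w (j + 0)  ≡⟨ cong w (+-identityʳ j) ⟩
  w j        ≡⟨ proj₁ (factor-suc-injective w j k n same) ⟩
  w k        ≡⟨ cong w (sym (+-identityʳ k)) ⟩
  w (k + 0)  ∎
  where open ≡-Reasoning
factor-pointwise w j k (suc n) same (suc m) (s≤s m<n) = begin
  w (j + suc m)  ≡⟨ cong w (+-suc j m) ⟩
  w (suc j + m)  ≡⟨ factor-pointwise w (suc j) (suc k) n (proj₂ (factor-suc-injective w j k n same)) m m<n ⟩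
  w (suc k + m)  ≡⟨ cong w (sym (+-suc k m)) ⟩
  w (k + suc m)  ∎
  where open ≡-Reasoning

factor-constant : ∀ w i n x → (∀ k → k < n → w (i + k) ≡ x) → factor w i n ≡ replicate n x
factor-constant w i zero x _ = refl
factor-constant w i (suc n) x const = trans (factor-suc w i n) (cong₂ _∷_ wi≡x rest)
  where
  wi≡x : w i ≡ x
  wi≡x = trans (cong w (sym (+-identityʳ i))) (const 0 z<s)
  rest : factor w (suc i) n ≡ replicate n x
  rest = factor-constant w (suc i) n x (λ k k<n → trans (cong w (sym (+-suc i k))) (const (suc k) (s≤s k<n)))

length-concat-replicate : ∀ d (v : Word) → length (concat (replicate d v)) ≡ d * length v
length-concat-replicate zero v = refl
length-concat-replicate (suc d) v = trans (length-++ v) (cong (length v +_) (length-concat-replicate d v))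

length-power : ∀ p q .{{_ : NonZero q}} (v : Word) k → length v ≡ k * q → length (power v p q) ≡ k * p
length-power p q v k |v|≡kq = begin
  length (concat (replicate d v) ++ take t v)         ≡⟨ length-++ (concat (replicate d v)) ⟩
  length (concat (replicate d v)) + length (take t v) ≡⟨ cong₂ _+_ (length-concat-replicate d v) (length-take t v) ⟩
  d * length v + t ⊓ length v                         ≡⟨ cong₂ _+_ (cong (d *_) |v|≡kq) (cong₂ _⊓_ t≡kr |v|≡kq) ⟩
  d * (k * q) + (k * r) ⊓ (k * q)                     ≡⟨ cong (d * (k * q) +_) (m≤n⇒m⊓n≡m (*-monoʳ-≤ k (<⇒≤ (m%n<n p q)))) ⟩
  d * (k * q) + k * r                                 ≡⟨ cong (_+ k * r) (*-comm d (k * q)) ⟩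
  k * q * d + k * r                                   ≡⟨ cong (_+ k * r) (*-assoc k q d) ⟩
  k * (q * d) + k * r                                 ≡⟨ sym (*-distribˡ-+ k (q * d) r) ⟩
  k * (q * d + r)                                     ≡⟨ cong (k *_) (trans (+-comm (q * d) r) (cong (r +_) (*-comm q d))) ⟩
  k * (r + d * q)                                     ≡⟨ cong (k *_) (sym (m≡m%n+[m/n]*n p q)) ⟩
  k * p                                               ∎
  where
  open ≡-Reasoning
  d r t : ℕ
  d = p / q
  r = p % q
  t = (length v * r) / q
  t≡kr : t ≡ k * r
  t≡kr = begin
    (length v * r) / q  ≡⟨ cong (λ L → (L * r) / q) |v|≡kq ⟩
    (k * q * r) / q     ≡⟨ cong (_/ q) (trans (*-assoc k q r) (trans (cong (k *_) (*-comm q r)) (sym (*-assoc k r q)))) ⟩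
    (k * r * q) / q     ≡⟨ m*n/n≡m (k * r) q ⟩
    k * r               ∎

shift-has-prefix : ∀ (v : Word) e t → ∃ λ s →
  v ++ (concat (replicate e v) ++ take t v) ≡ (concat (replicate e v) ++ take t v) ++ s
shift-has-prefix v zero t = drop t v ++ take t v , (begin
  v ++ take t v                       ≡⟨ cong (_++ take t v) (sym (take++drop≡id t v)) ⟩
  (take t v ++ drop t v) ++ take t v  ≡⟨ ++-assoc (take t v) (drop t v) (take t v) ⟩
  take t v ++ (drop t v ++ take t v)  ∎)
  where open ≡-Reasoning
shift-has-prefix v (suc e) t with shift-has-prefix v e t
... | s , v++x≡x++s = s , (begin
  v ++ ((v ++ C) ++ T)   ≡⟨ cong (v ++_) (++-assoc v C T) ⟩
  v ++ (v ++ (C ++ T))   ≡⟨ cong (v ++_) v++x≡x++s ⟩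
  v ++ ((C ++ T) ++ s)   ≡⟨ sym (++-assoc v (C ++ T) s) ⟩
  (v ++ (C ++ T)) ++ s   ≡⟨ cong (_++ s) (sym (++-assoc v C T)) ⟩
  ((v ++ C) ++ T) ++ s   ∎)
  where
  open ≡-Reasoning
  C T : Word
  C = concat (replicate e v)
  T = take t v

root-border : ∀ (v : Word) d t → 1 ≤ d → ∃₂ λ r s →
  (concat (replicate d v) ++ take t v ≡ v ++ r) × (concat (replicate d v) ++ take t v ≡ r ++ s)
root-border v (suc e) t _ with shift-has-prefix v e t
... | s , v++r≡r++s = concat (replicate e v) ++ take t v , s , x≡v++r , trans x≡v++r v++r≡r++s
  where
  x≡v++r : concat (replicate (suc e) v) ++ take t v ≡ v ++ (concat (replicate e v) ++ take t v)
  x≡v++r = ++-assoc v (concat (replicate e v)) (take t v)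

power-singleton : ∀ x n → power [ x ] n 1 ≡ replicate n x
power-singleton x n rewrite n/1≡n n | n%1≡0 n = begin
  concat (replicate n [ x ]) ++ []  ≡⟨ ++-identityʳ _ ⟩
  concat (replicate n [ x ])        ≡⟨ cong concat (sym (map-replicate [_] n x)) ⟩
  concat (map [_] (replicate n x))  ≡⟨ concat-map-[ replicate n x ] ⟩
  replicate n x                     ∎
  where open ≡-Reasoning

power-root-bounds : ∀ p q .{{_ : NonZero q}} → q < p → (v : Word) → v ≢ [] → q ∣ length v →
  0 < length v × length v < length (power v p q) × p ≤ length (power v p q)
power-root-bounds p q q<p [] v≢[] _ = ⊥-elim (v≢[] refl)
power-root-bounds p q q<p (_ ∷ _) _ (divides zero ())
power-root-bounds p q q<p v@(_ ∷ _) _ (divides (suc k) |v|≡kq) =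
  z<s ,
  subst₂ _<_ (sym |v|≡kq) (sym |power|≡kp) (*-monoʳ-< (suc k) q<p) ,
  subst (p ≤_) (sym |power|≡kp) (m≤m+n p (k * p))
  where
  |power|≡kp : length (power v p q) ≡ suc k * p
  |power|≡kp = length-power p q v (suc k) |v|≡kq

power-occurrence-repeats : ∀ p q .{{_ : NonZero q}} → q < p → ∀ w i n → IsPower p q (factor w i n) →
  ∃₂ λ x y → x < y × p ≤ suc y × w y ≡ w x
power-occurrence-repeats p q q<p w i n (v , v≢[] , q∣|v| , occ)
  with power-root-bounds p q q<p v v≢[] q∣|v|
     | root-border v (p / q) ((length v * (p % q)) / q) (m≥n⇒m/n>0 (<⇒≤ q<p))
... | 0<L , L<|power| , p≤|power| | r , s , power≡v++r , power≡r++s =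
  i + m , i + L + m , +-monoˡ-< m (m<m+n i 0<L) , p≤1+y , repeat
  where
  L R : ℕ
  L = length v
  R = length r
  |power|≡L+R : length (power v p q) ≡ L + R
  |power|≡L+R = trans (cong length power≡v++r) (length-++ v)
  0<R : 0 < R
  0<R = +-cancelˡ-< L 0 R (subst₂ _<_ (sym (+-identityʳ L)) |power|≡L+R L<|power|)
  instance
    R-nonZero : NonZero R
    R-nonZero = >-nonZero 0<R
  m : ℕ
  m = pred R
  r≡shifted : r ≡ factor w (i + L) R
  r≡shifted = proj₂ (factor-++ w i n v r (trans occ power≡v++r))
  r≡prefix : r ≡ factor w i R
  r≡prefix = proj₁ (factor-++ w i n r s (trans occ power≡r++s))
  repeat : w (i + L + m) ≡ w (i + m)
  repeat = factor-pointwise w (i + L) i R (trans (sym r≡shifted) r≡prefix) m (≤-reflexive (suc-pred R))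
  p≤1+y : p ≤ suc (i + L + m)
  p≤1+y = begin
    p                      ≤⟨ p≤|power| ⟩
    length (power v p q)   ≡⟨ |power|≡L+R ⟩
    L + R                  ≡⟨ cong (L +_) (sym (suc-pred R)) ⟩
    L + suc m              ≡⟨ +-suc L m ⟩
    suc (L + m)            ≤⟨ s≤s (m≤n+m (L + m) i) ⟩
    suc (i + (L + m))      ≡⟨ cong suc (sym (+-assoc i L m)) ⟩
    suc (i + L + m)        ∎
    where open ≤-Reasoning

FreshAfter : ℕ → InfWord → Set
FreshAfter h w = ∀ x y → x < y → h < y → w y ≢ w x

-- If q < p and h + 1 < p, a word that is fresh after position h avoids p/q-powers,
-- since every occurrence would repeat a letter at a position ≥ p − 1 > h.
fresh-avoids : ∀ p q .{{_ : NonZero q}} → q < p → ∀ h w → suc h < p → FreshAfter h w → Avoids p q w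
fresh-avoids p q q<p h w 1+h<p fresh i n isPower with power-occurrence-repeats p q q<p w i n isPower
... | x , y , x<y , p≤1+y , wy≡wx = fresh x y x<y (≤-pred (≤-trans 1+h<p p≤1+y)) wy≡wx

zerosThenPositions : ℕ → InfWord
zerosThenPositions h j with j ≤? h
... | yes _ = 0
... | no _ = j

zerosThenPositions-zero : ∀ h j → j ≤ h → zerosThenPositions h j ≡ 0
zerosThenPositions-zero h j j≤h with j ≤? h
... | yes _ = refl
... | no j≰h = contradiction j≤h j≰h

zerosThenPositions-fresh : ∀ h → FreshAfter h (zerosThenPositions h)
zerosThenPositions-fresh h x y x<y h<y with y ≤? h
... | yes y≤h = contradiction y≤h (<⇒≱ h<y)
... | no _ with x ≤? h
...   | yes _ = >⇒≢ (≤-<-trans z≤n h<y)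
...   | no _ = >⇒≢ x<y

lexLeast-zero-prefix : ∀ a b .{{_ : NonZero b}} → b < a → ∀ w → IsLexLeast (Avoids a b) w →
  ∀ j → suc j < a → w j ≡ 0
lexLeast-zero-prefix a b b<a w (_ , least) j 1+j<a = zeros-below (suc j) 1+j<a j ≤-refl
  where
  -- if w vanishes before m and m + 1 < a, then w m = 0, for otherwise
  -- zerosThenPositions m would be a lexicographically smaller a/b-power-free word
  next-zero : ∀ m → suc m < a → (∀ k → k < m → w k ≡ 0) → w m ≡ 0
  next-zero m 1+m<a zeros = n≤0⇒n≡0 (≮⇒≥ λ 0<wm → least (zerosThenPositions m)
    (fresh-avoids a b b<a m (zerosThenPositions m) 1+m<a (zerosThenPositions-fresh m))
    (m , (λ k k<m → trans (zerosThenPositions-zero m k (<⇒≤ k<m)) (sym (zeros k k<m))) ,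
         subst (_< w m) (sym (zerosThenPositions-zero m m ≤-refl)) 0<wm))
  zeros-below : ∀ m → m < a → ∀ k → k < m → w k ≡ 0
  zeros-below (suc m) 1+m<a k k<1+m with m<1+n⇒m<n∨m≡n k<1+m
  ... | inj₁ k<m = zeros-below m (<-trans (n<1+n m) 1+m<a) k k<m
  ... | inj₂ refl = next-zero k 1+m<a (zeros-below k (<-trans (n<1+n k) 1+m<a))

≤-next-multiple : ∀ a b .{{_ : NonZero b}} → a ≤ suc (a / b) * b
≤-next-multiple a b = begin
  a                   ≡⟨ m≡m%n+[m/n]*n a b ⟩
  a % b + a / b * b   ≤⟨ +-monoˡ-≤ (a / b * b) (<⇒≤ (m%n<n a b)) ⟩
  b + a / b * b       ∎
  where open ≤-Reasoning

next-quotient-< : ∀ a b .{{_ : NonZero b}} → 2 ≤ b → b < a → suc (a / b) < a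
next-quotient-< a b 2≤b b<a =
  bound (a / b) (≤-trans (*-monoʳ-≤ (a / b) 2≤b) (m/n*n≤m a b)) (≤-trans (s≤s 2≤b) b<a)
  where
  bound : ∀ d → d * 2 ≤ a → 3 ≤ a → suc d < a
  bound zero _ 3≤a = ≤-trans (n≤1+n 2) 3≤a
  bound (suc zero) _ 3≤a = 3≤a
  bound (suc (suc e)) 2d≤a _ = ≤-trans (s≤s (s≤s (s≤s (s≤s (m≤m*n e 2))))) 2d≤a

proposition2p12 : (a b : ℕ) .{{_ : NonZero b}} → Coprime a b → b < a → 2 ≤ b →
    (w w≥ : InfWord) → IsLexLeast (Avoids a b) w → IsLexLeast (AvoidsGE a b) w≥ →
    ¬ (∀ i → w≥ i ≡ w i)
proposition2p12 a b _ b<a 2≤b w w≥ w-least (w≥-avoids , _) w≥≡w =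
  w≥-avoids c 1 (coprime-sym (1-coprimeTo c)) c≥a/b 0 c ([ 0 ] , (λ ()) , 1∣ 1 , zero-block)
  where
  c : ℕ
  c = suc (a / b)
  c≥a/b : a * 1 ≤ c * b
  c≥a/b = subst (_≤ c * b) (sym (*-identityʳ a)) (≤-next-multiple a b)
  starts-with-zeros : ∀ k → k < c → w≥ (0 + k) ≡ 0
  starts-with-zeros k k<c =
    trans (w≥≡w k) (lexLeast-zero-prefix a b b<a w w-least k (≤-<-trans k<c (next-quotient-< a b 2≤b b<a)))
  zero-block : factor w≥ 0 c ≡ power [ 0 ] c 1
  zero-block = trans (factor-constant w≥ 0 c 0 starts-with-zeros) (sym (power-singleton 0 c))
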